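{- For every integer $n\geq 2$, $$ \sum_{k=0}^n k\binom{n}{k}(-1)^kH_{n-k}=(-1)^{n-1}\frac{n}{n-1}. $$
   Context: $H_m=1+\frac12+\cdots+\frac1m$ denotes the $m$-th harmonic number, with $H_0=0$. -}

module Defs where

open import Data.Nat using (ℕ; zero; suc)
open import Data.Integer using (+_)
open import Data.Rational using (ℚ; 0ℚ; 1ℚ; _+_; _/_; -_)

H : ℕ → ℚ
H zero = 0ℚ
H (suc m) = H m + (+ 1) / suc m

sumTo : ℕ → (ℕ → ℚ) → ℚ
sumTo zero f = f zero
sumTo (suc n) f = sumTo n f + f (suc n)

sign : ℕ → ℚ
sign zero = 1ℚ
sign (suc k) = - sign k

{-# OPTIONS --safe #-}
module Submission where

-- Absorption, k·C(n,k) = n·C(n−1,k−1), turns the sum into −n·T(n−1), where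
-- T(N) = Σ_j C(N,j) (−1)^j H_{N−j}. Pascal's rule splits T(N+1) into two sums over
-- C(N,j) whose difference only sees H_{N+1−j} − H_{N−j} = 1/(N+1−j); since
-- C(N,j)/(N+1−j) = C(N+1,j)/(N+1), what is left is 1/(N+1) times an alternating
-- binomial sum missing its last term, so T(N+1) = (−1)^N/(N+1).

open import Defs
open import Data.Nat using (ℕ; suc; _≤_; _∸_)
open import Data.Nat.Combinatorics using (_C_)
open import Data.Integer using (+_)
open import Data.Rational using (ℚ; _*_; _/_)
open import Relation.Binary.PropositionalEquality using (_≡_)

open import Function.Base using (_∘_)
open import Data.Nat as ℕ using (zero; z≤n)
import Data.Nat.Properties as ℕ
open import Data.Nat.Combinatorics
  using (nC1≡n; nCn≡1; k>n⇒nCk≡0; nCk+nC[k+1]≡[n+1]C[k+1])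
import Data.Nat.Tactic.RingSolver as ℕ-Solver
import Data.Integer as ℤ
import Data.Integer.Properties as ℤ
import Data.Integer.Tactic.RingSolver as ℤ-Solver
open import Data.Rational using (0ℚ; 1ℚ; _+_; -_; toℚᵘ)
open import Data.Rational.Properties
  using (toℚᵘ-injective; toℚᵘ-fromℚᵘ; toℚᵘ-homo-+; toℚᵘ-homo-*;
         +-identityˡ; +-identityʳ; +-assoc; +-inverseʳ; neg-distrib-+; neg-distribʳ-*; *-identityʳ; *-zeroˡ; *-distribˡ-+; *-distribʳ-+)
open import Data.Rational.Unnormalised as ℚᵘ using (mkℚᵘ; *≡*) renaming (_≃_ to _≃ᵘ_)
import Data.Rational.Unnormalised.Properties as ℚᵘ
open import Data.Rational.Solver using (module +-*-Solver)
open +-*-Solver using (solve; _:+_; _:*_; :-_; _:=_; con)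
open import Relation.Binary.PropositionalEquality using (refl; sym; trans; cong; cong₂; module ≡-Reasoning)

fromℕ : ℕ → ℚ
fromℕ a = + a / 1

1/[1+_] : ℕ → ℚ
1/[1+ a ] = + 1 / suc a

-- Here `+ a / suc b` unfolds to `fromℚᵘ (mkℚᵘ (+ a) b)`.
toℚᵘ-+/suc : ∀ a b → toℚᵘ (+ a / suc b) ≃ᵘ mkℚᵘ (+ a) b
toℚᵘ-+/suc a b = toℚᵘ-fromℚᵘ (mkℚᵘ (+ a) b)

fromℕ-+ : ∀ a b → fromℕ (a ℕ.+ b) ≡ fromℕ a + fromℕ b
fromℕ-+ a b = toℚᵘ-injective (begin
  toℚᵘ (fromℕ (a ℕ.+ b))              ≈⟨ toℚᵘ-+/suc (a ℕ.+ b) 0 ⟩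
  mkℚᵘ (+ (a ℕ.+ b)) 0                ≈⟨ *≡* (trans (cong (ℤ._* ℤ.1ℤ) (ℤ.pos-+ a b)) (over1 (+ a) (+ b))) ⟩
  mkℚᵘ (+ a) 0 ℚᵘ.+ mkℚᵘ (+ b) 0      ≈⟨ ℚᵘ.+-cong (toℚᵘ-+/suc a 0) (toℚᵘ-+/suc b 0) ⟨
  toℚᵘ (fromℕ a) ℚᵘ.+ toℚᵘ (fromℕ b)  ≈⟨ toℚᵘ-homo-+ (fromℕ a) (fromℕ b) ⟨
  toℚᵘ (fromℕ a + fromℕ b)            ∎)
  where
  open ℚᵘ.≃-Reasoning
  over1 : ∀ x y → (x ℤ.+ y) ℤ.* ℤ.1ℤ ≡ (x ℤ.* ℤ.1ℤ ℤ.+ y ℤ.* ℤ.1ℤ) ℤ.* ℤ.1ℤ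
  over1 = ℤ-Solver.solve-∀

fromℕ-* : ∀ a b → fromℕ (a ℕ.* b) ≡ fromℕ a * fromℕ b
fromℕ-* a b = toℚᵘ-injective (begin
  toℚᵘ (fromℕ (a ℕ.* b))              ≈⟨ toℚᵘ-+/suc (a ℕ.* b) 0 ⟩
  mkℚᵘ (+ (a ℕ.* b)) 0                ≈⟨ *≡* (cong (ℤ._* ℤ.1ℤ) (ℤ.pos-* a b)) ⟩
  mkℚᵘ (+ a) 0 ℚᵘ.* mkℚᵘ (+ b) 0      ≈⟨ ℚᵘ.*-cong (toℚᵘ-+/suc a 0) (toℚᵘ-+/suc b 0) ⟨
  toℚᵘ (fromℕ a) ℚᵘ.* toℚᵘ (fromℕ b)  ≈⟨ toℚᵘ-homo-* (fromℕ a) (fromℕ b) ⟨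
  toℚᵘ (fromℕ a * fromℕ b)            ∎)
  where open ℚᵘ.≃-Reasoning

+/suc≡fromℕ*1/[1+] : ∀ a b → + a / suc b ≡ fromℕ a * 1/[1+ b ]
+/suc≡fromℕ*1/[1+] a b = toℚᵘ-injective (begin
  toℚᵘ (+ a / suc b)                      ≈⟨ toℚᵘ-+/suc a b ⟩
  mkℚᵘ (+ a) b                            ≈⟨ *≡* (scale (+ a) (+ suc b)) ⟩
  mkℚᵘ (+ a) 0 ℚᵘ.* mkℚᵘ (+ 1) b          ≈⟨ ℚᵘ.*-cong (toℚᵘ-+/suc a 0) (toℚᵘ-+/suc 1 b) ⟨
  toℚᵘ (fromℕ a) ℚᵘ.* toℚᵘ 1/[1+ b ]      ≈⟨ toℚᵘ-homo-* (fromℕ a) 1/[1+ b ] ⟨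
  toℚᵘ (fromℕ a * 1/[1+ b ])              ∎)
  where
  open ℚᵘ.≃-Reasoning
  scale : ∀ x d → x ℤ.* (ℤ.1ℤ ℤ.* d) ≡ (x ℤ.* ℤ.1ℤ) ℤ.* d
  scale = ℤ-Solver.solve-∀

fromℕ[1+a]*1/[1+a]≡1 : ∀ a → fromℕ (suc a) * 1/[1+ a ] ≡ 1ℚ
fromℕ[1+a]*1/[1+a]≡1 a = trans (sym (+/suc≡fromℕ*1/[1+] (suc a) a)) (toℚᵘ-injective (begin
  toℚᵘ (+ suc a / suc a)  ≈⟨ toℚᵘ-+/suc (suc a) a ⟩
  mkℚᵘ (+ suc a) a        ≈⟨ *≡* (ℤ.*-comm (+ suc a) ℤ.1ℤ) ⟩
  ℚᵘ.1ℚᵘ                  ∎))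
  where open ℚᵘ.≃-Reasoning

1/[1+]-swap : ∀ a b x y → fromℕ (suc a) * x ≡ fromℕ (suc b) * y → y * 1/[1+ a ] ≡ 1/[1+ b ] * x
1/[1+]-swap a b x y eq = begin
  y * 1/[1+ a ]                      ≡⟨ *-identityʳ (y * 1/[1+ a ]) ⟨
  y * 1/[1+ a ] * 1ℚ                 ≡⟨ cong (y * 1/[1+ a ] *_) (fromℕ[1+a]*1/[1+a]≡1 b) ⟨
  y * 1/[1+ a ] * (B * 1/[1+ b ])    ≡⟨ regroup y 1/[1+ a ] B 1/[1+ b ] ⟩
  1/[1+ b ] * (B * y) * 1/[1+ a ]    ≡⟨ cong (λ z → 1/[1+ b ] * z * 1/[1+ a ]) eq ⟨
  1/[1+ b ] * (A * x) * 1/[1+ a ]    ≡⟨ regroup′ 1/[1+ b ] A x 1/[1+ a ] ⟩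
  1/[1+ b ] * x * (A * 1/[1+ a ])    ≡⟨ cong (1/[1+ b ] * x *_) (fromℕ[1+a]*1/[1+a]≡1 a) ⟩
  1/[1+ b ] * x * 1ℚ                 ≡⟨ *-identityʳ (1/[1+ b ] * x) ⟩
  1/[1+ b ] * x                      ∎
  where
  open ≡-Reasoning
  A = fromℕ (suc a)
  B = fromℕ (suc b)
  regroup : ∀ p q r s → p * q * (r * s) ≡ s * (r * p) * q
  regroup = solve 4 (λ p q r s → p :* q :* (r :* s) := s :* (r :* p) :* q) refl
  regroup′ : ∀ p q r s → p * (q * r) * s ≡ p * r * (q * s)
  regroup′ = solve 4 (λ p q r s → p :* (q :* r) :* s := p :* r :* (q :* s)) refl

sumTo-cong : ∀ n {f g : ℕ → ℚ} → (∀ k → k ≤ n → f k ≡ g k) → sumTo n f ≡ sumTo n g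
sumTo-cong zero    f≗g = f≗g 0 z≤n
sumTo-cong (suc n) f≗g =
  cong₂ _+_ (sumTo-cong n (λ k k≤n → f≗g k (ℕ.m≤n⇒m≤1+n k≤n))) (f≗g (suc n) ℕ.≤-refl)

sumTo-+ : ∀ n (f g : ℕ → ℚ) → sumTo n (λ k → f k + g k) ≡ sumTo n f + sumTo n g
sumTo-+ zero    f g = refl
sumTo-+ (suc n) f g =
  trans (cong (_+ (f (suc n) + g (suc n))) (sumTo-+ n f g))
        (interchange (sumTo n f) (sumTo n g) (f (suc n)) (g (suc n)))
  where
  interchange : ∀ a b c d → (a + b) + (c + d) ≡ (a + c) + (b + d)
  interchange = solve 4 (λ a b c d → (a :+ b) :+ (c :+ d) := (a :+ c) :+ (b :+ d)) refl

sumTo-*ˡ : ∀ n a (f : ℕ → ℚ) → sumTo n (λ k → a * f k) ≡ a * sumTo n f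
sumTo-*ˡ zero    a f = refl
sumTo-*ˡ (suc n) a f =
  trans (cong (_+ a * f (suc n)) (sumTo-*ˡ n a f)) (sym (*-distribˡ-+ a (sumTo n f) (f (suc n))))

sumTo-neg : ∀ n (f : ℕ → ℚ) → sumTo n (λ k → - f k) ≡ - sumTo n f
sumTo-neg zero    f = refl
sumTo-neg (suc n) f =
  trans (cong (_+ - f (suc n)) (sumTo-neg n f)) (sym (neg-distrib-+ (sumTo n f) (f (suc n))))

sumTo-suc : ∀ n (f : ℕ → ℚ) → sumTo (suc n) f ≡ f 0 + sumTo n (f ∘ suc)
sumTo-suc zero    f = refl
sumTo-suc (suc n) f = trans (cong (_+ f (suc (suc n))) (sumTo-suc n f)) (+-assoc (f 0) _ _)

[k+1]*[n+1]C[k+1]≡[n+1]*nCk : ∀ n k → suc k ℕ.* (suc n C suc k) ≡ suc n ℕ.* (n C k)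
[k+1]*[n+1]C[k+1]≡[n+1]*nCk zero    zero    = refl
[k+1]*[n+1]C[k+1]≡[n+1]*nCk zero    (suc k) = ℕ.*-zeroʳ (suc (suc k))
[k+1]*[n+1]C[k+1]≡[n+1]*nCk (suc n) zero    =
  trans (ℕ.+-identityʳ _) (trans (nC1≡n (suc (suc n))) (sym (ℕ.*-identityʳ (suc (suc n)))))
[k+1]*[n+1]C[k+1]≡[n+1]*nCk (suc n) (suc k) = begin
  suc (suc k) ℕ.* (suc (suc n) C suc (suc k))
    ≡⟨ cong (suc (suc k) ℕ.*_) (nCk+nC[k+1]≡[n+1]C[k+1] (suc n) (suc k)) ⟨
  suc (suc k) ℕ.* (a ℕ.+ b)
    ≡⟨ split (suc k) a b ⟩
  suc k ℕ.* a ℕ.+ a ℕ.+ suc (suc k) ℕ.* b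
    ≡⟨ cong₂ (λ x y → x ℕ.+ a ℕ.+ y) ([k+1]*[n+1]C[k+1]≡[n+1]*nCk n k)
                                      ([k+1]*[n+1]C[k+1]≡[n+1]*nCk n (suc k)) ⟩
  suc n ℕ.* (n C k) ℕ.+ a ℕ.+ suc n ℕ.* (n C suc k)
    ≡⟨ merge (suc n) (n C k) (n C suc k) a ⟩
  suc n ℕ.* (n C k ℕ.+ n C suc k) ℕ.+ a
    ≡⟨ cong (λ x → suc n ℕ.* x ℕ.+ a) (nCk+nC[k+1]≡[n+1]C[k+1] n k) ⟩
  suc n ℕ.* a ℕ.+ a
    ≡⟨ ℕ.+-comm (suc n ℕ.* a) a ⟩
  suc (suc n) ℕ.* a ∎
  where
  open ≡-Reasoning
  a = suc n C suc k
  b = suc n C suc (suc k)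
  split : ∀ k a b → suc k ℕ.* (a ℕ.+ b) ≡ k ℕ.* a ℕ.+ a ℕ.+ suc k ℕ.* b
  split = ℕ-Solver.solve-∀
  merge : ∀ m p q a → m ℕ.* p ℕ.+ a ℕ.+ m ℕ.* q ≡ m ℕ.* (p ℕ.+ q) ℕ.+ a
  merge = ℕ-Solver.solve-∀

[n+1]*[n+1]Ck≡k*[n+1]Ck+[n+1]*nCk : ∀ n k →
  suc n ℕ.* (suc n C k) ≡ k ℕ.* (suc n C k) ℕ.+ suc n ℕ.* (n C k)
[n+1]*[n+1]Ck≡k*[n+1]Ck+[n+1]*nCk n zero    = refl
[n+1]*[n+1]Ck≡k*[n+1]Ck+[n+1]*nCk n (suc k) = begin
  suc n ℕ.* (suc n C suc k)                              ≡⟨ cong (suc n ℕ.*_) (nCk+nC[k+1]≡[n+1]C[k+1] n k) ⟨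
  suc n ℕ.* (n C k ℕ.+ n C suc k)                        ≡⟨ ℕ.*-distribˡ-+ (suc n) (n C k) (n C suc k) ⟩
  suc n ℕ.* (n C k) ℕ.+ suc n ℕ.* (n C suc k)            ≡⟨ cong (ℕ._+ suc n ℕ.* (n C suc k)) ([k+1]*[n+1]C[k+1]≡[n+1]*nCk n k) ⟨
  suc k ℕ.* (suc n C suc k) ℕ.+ suc n ℕ.* (n C suc k)    ∎
  where open ≡-Reasoning

[n+1-k]*[n+1]Ck≡[n+1]*nCk : ∀ {n k} → k ≤ n → suc (n ∸ k) ℕ.* (suc n C k) ≡ suc n ℕ.* (n C k)
[n+1-k]*[n+1]Ck≡[n+1]*nCk {n} {k} k≤n = ℕ.+-cancelˡ-≡ (k ℕ.* (suc n C k)) _ _ (begin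
  k ℕ.* (suc n C k) ℕ.+ suc (n ∸ k) ℕ.* (suc n C k)    ≡⟨ ℕ.*-distribʳ-+ (suc n C k) k (suc (n ∸ k)) ⟨
  (k ℕ.+ suc (n ∸ k)) ℕ.* (suc n C k)                  ≡⟨ cong (ℕ._* (suc n C k)) k+[n+1-k]≡n+1 ⟩
  suc n ℕ.* (suc n C k)                                ≡⟨ [n+1]*[n+1]Ck≡k*[n+1]Ck+[n+1]*nCk n k ⟩
  k ℕ.* (suc n C k) ℕ.+ suc n ℕ.* (n C k)              ∎)
  where
  open ≡-Reasoning
  k+[n+1-k]≡n+1 : k ℕ.+ suc (n ∸ k) ≡ suc n
  k+[n+1-k]≡n+1 = trans (ℕ.+-suc k (n ∸ k)) (cong suc (ℕ.m+[n∸m]≡n k≤n))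

infix 8 _Cℚ_

_Cℚ_ : ℕ → ℕ → ℚ
n Cℚ k = fromℕ (n C k)

nCℚk+nCℚ[k+1]≡[n+1]Cℚ[k+1] : ∀ n k → n Cℚ k + n Cℚ suc k ≡ suc n Cℚ suc k
nCℚk+nCℚ[k+1]≡[n+1]Cℚ[k+1] n k =
  trans (sym (fromℕ-+ (n C k) (n C suc k))) (cong fromℕ (nCk+nC[k+1]≡[n+1]C[k+1] n k))

[k+1]*[n+1]Cℚ[k+1]≡[n+1]*nCℚk : ∀ n k → fromℕ (suc k ℕ.* (suc n C suc k)) ≡ fromℕ (suc n) * n Cℚ k
[k+1]*[n+1]Cℚ[k+1]≡[n+1]*nCℚk n k =
  trans (cong fromℕ ([k+1]*[n+1]C[k+1]≡[n+1]*nCk n k)) (fromℕ-* (suc n) (n C k))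

nCℚk*1/[1+n-k]≡1/[1+n]*[n+1]Cℚk : ∀ {n k} → k ≤ n → n Cℚ k * 1/[1+ n ∸ k ] ≡ 1/[1+ n ] * suc n Cℚ k
nCℚk*1/[1+n-k]≡1/[1+n]*[n+1]Cℚk {n} {k} k≤n = 1/[1+]-swap (n ∸ k) n (suc n Cℚ k) (n Cℚ k) (begin
  fromℕ (suc (n ∸ k)) * suc n Cℚ k        ≡⟨ fromℕ-* (suc (n ∸ k)) (suc n C k) ⟨
  fromℕ (suc (n ∸ k) ℕ.* (suc n C k))     ≡⟨ cong fromℕ ([n+1-k]*[n+1]Ck≡[n+1]*nCk k≤n) ⟩
  fromℕ (suc n ℕ.* (n C k))               ≡⟨ fromℕ-* (suc n) (n C k) ⟩
  fromℕ (suc n) * n Cℚ k                  ∎)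
  where open ≡-Reasoning

sumTo-binomial-pascal : ∀ n (g : ℕ → ℚ) →
  sumTo (suc n) (λ j → suc n Cℚ j * g j)
    ≡ sumTo n (λ j → n Cℚ j * g j) + sumTo n (λ j → n Cℚ j * g (suc j))
sumTo-binomial-pascal n g = begin
  sumTo (suc n) (λ j → suc n Cℚ j * g j)
    ≡⟨ sumTo-suc n _ ⟩
  c₀ + sumTo n (λ j → suc n Cℚ suc j * g (suc j))
    ≡⟨ cong (_+_ c₀) (sumTo-cong n (λ j _ → pascal-split j)) ⟩
  c₀ + sumTo n (λ j → n Cℚ j * g (suc j) + n Cℚ suc j * g (suc j))
    ≡⟨ cong (_+_ c₀) (sumTo-+ n _ _) ⟩
  c₀ + (B + C)
    ≡⟨ rearrange c₀ B C ⟩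
  (c₀ + C) + B
    ≡⟨ cong (_+ B) A≡c₀+C ⟨
  A + B ∎
  where
  open ≡-Reasoning
  c₀ = n Cℚ 0 * g 0
  A = sumTo n (λ j → n Cℚ j * g j)
  B = sumTo n (λ j → n Cℚ j * g (suc j))
  C = sumTo n (λ j → n Cℚ suc j * g (suc j))
  pascal-split : ∀ j → suc n Cℚ suc j * g (suc j) ≡ n Cℚ j * g (suc j) + n Cℚ suc j * g (suc j)
  pascal-split j = trans (cong (_* g (suc j)) (sym (nCℚk+nCℚ[k+1]≡[n+1]Cℚ[k+1] n j)))
                         (*-distribʳ-+ (g (suc j)) (n Cℚ j) (n Cℚ suc j))
  rearrange : ∀ x b c → x + (b + c) ≡ (x + c) + b
  rearrange = solve 3 (λ x b c → x :+ (b :+ c) := (x :+ c) :+ b) refl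
  A≡c₀+C : A ≡ c₀ + C
  A≡c₀+C = begin
    A                                   ≡⟨ +-identityʳ A ⟨
    A + 0ℚ                              ≡⟨ cong (_+_ A) (*-zeroˡ (g (suc n))) ⟨
    A + 0ℚ * g (suc n)                  ≡⟨ cong (λ z → A + fromℕ z * g (suc n)) (k>n⇒nCk≡0 (ℕ.n<1+n n)) ⟨
    sumTo (suc n) (λ j → n Cℚ j * g j)  ≡⟨ sumTo-suc n _ ⟩
    c₀ + C                              ∎

alternating-binomial-sum : ∀ n → sumTo (suc n) (λ j → suc n Cℚ j * sign j) ≡ 0ℚ
alternating-binomial-sum n = begin
  sumTo (suc n) (λ j → suc n Cℚ j * sign j)   ≡⟨ sumTo-binomial-pascal n sign ⟩
  A + sumTo n (λ j → n Cℚ j * - sign j)       ≡⟨ cong (_+_ A) (sumTo-cong n (λ j _ → sym (neg-distribʳ-* (n Cℚ j) (sign j)))) ⟩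
  A + sumTo n (λ j → - (n Cℚ j * sign j))     ≡⟨ cong (_+_ A) (sumTo-neg n _) ⟩
  A + - A                                     ≡⟨ +-inverseʳ A ⟩
  0ℚ                                          ∎
  where
  open ≡-Reasoning
  A = sumTo n (λ j → n Cℚ j * sign j)

alternating-binomial-sum-init : ∀ n → sumTo n (λ j → suc n Cℚ j * sign j) ≡ sign n
alternating-binomial-sum-init n = begin
  Z                                                   ≡⟨ add-cancel Z (sign n) ⟩
  (Z + 1ℚ * - sign n) + sign n                        ≡⟨ cong (λ w → (Z + fromℕ w * - sign n) + sign n) (nCn≡1 (suc n)) ⟨
  sumTo (suc n) (λ j → suc n Cℚ j * sign j) + sign n  ≡⟨ cong (_+ sign n) (alternating-binomial-sum n) ⟩
  0ℚ + sign n                                         ≡⟨ +-identityˡ (sign n) ⟩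
  sign n                                              ∎
  where
  open ≡-Reasoning
  Z = sumTo n (λ j → suc n Cℚ j * sign j)
  add-cancel : ∀ z s → z ≡ (z + 1ℚ * - s) + s
  add-cancel = solve 2 (λ z s → z := (z :+ con 1ℚ :* (:- s)) :+ s) refl

binomialHarmonic : ℕ → ℚ
binomialHarmonic n = sumTo n (λ j → n Cℚ j * (sign j * H (n ∸ j)))

binomialHarmonic-suc : ∀ n → binomialHarmonic (suc n) ≡ 1/[1+ n ] * sign n
binomialHarmonic-suc n = begin
  binomialHarmonic (suc n)
    ≡⟨ sumTo-binomial-pascal n (λ j → sign j * H (suc n ∸ j)) ⟩
  sumTo n (λ j → n Cℚ j * (sign j * H (suc n ∸ j))) + sumTo n (λ j → n Cℚ j * (- sign j * H (n ∸ j)))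
    ≡⟨ sumTo-+ n _ _ ⟨
  sumTo n (λ j → n Cℚ j * (sign j * H (suc n ∸ j)) + n Cℚ j * (- sign j * H (n ∸ j)))
    ≡⟨ sumTo-cong n telescope ⟩
  sumTo n (λ j → 1/[1+ n ] * (suc n Cℚ j * sign j))
    ≡⟨ sumTo-*ˡ n 1/[1+ n ] _ ⟩
  1/[1+ n ] * sumTo n (λ j → suc n Cℚ j * sign j)
    ≡⟨ cong (1/[1+ n ] *_) (alternating-binomial-sum-init n) ⟩
  1/[1+ n ] * sign n ∎
  where
  open ≡-Reasoning
  difference : ∀ c s h r → c * (s * (h + r)) + c * (- s * h) ≡ s * (c * r)
  difference = solve 4 (λ c s h r → c :* (s :* (h :+ r)) :+ c :* (:- s :* h) := s :* (c :* r)) refl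
  reorder : ∀ s r c → s * (r * c) ≡ r * (c * s)
  reorder = solve 3 (λ s r c → s :* (r :* c) := r :* (c :* s)) refl
  telescope : ∀ j → j ≤ n →
    n Cℚ j * (sign j * H (suc n ∸ j)) + n Cℚ j * (- sign j * H (n ∸ j)) ≡ 1/[1+ n ] * (suc n Cℚ j * sign j)
  telescope j j≤n = begin
    n Cℚ j * (sign j * H (suc n ∸ j)) + n Cℚ j * (- sign j * H (n ∸ j))
      ≡⟨ cong (λ i → n Cℚ j * (sign j * H i) + n Cℚ j * (- sign j * H (n ∸ j))) (ℕ.+-∸-assoc 1 j≤n) ⟩
    n Cℚ j * (sign j * (H (n ∸ j) + 1/[1+ n ∸ j ])) + n Cℚ j * (- sign j * H (n ∸ j))
      ≡⟨ difference (n Cℚ j) (sign j) (H (n ∸ j)) 1/[1+ n ∸ j ] ⟩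
    sign j * (n Cℚ j * 1/[1+ n ∸ j ])
      ≡⟨ cong (sign j *_) (nCℚk*1/[1+n-k]≡1/[1+n]*[n+1]Cℚk j≤n) ⟩
    sign j * (1/[1+ n ] * suc n Cℚ j)
      ≡⟨ reorder (sign j) 1/[1+ n ] (suc n Cℚ j) ⟩
    1/[1+ n ] * (suc n Cℚ j * sign j) ∎

lemma2p8 : ∀ (m : ℕ) → let n = suc (suc m) in
    sumTo n (λ k → ((+ (k Data.Nat.* (n C k))) / 1) * sign k * H (n ∸ k))
      ≡ sign (n ∸ 1) * ((+ n) / suc m)
lemma2p8 m = begin
  sumTo (suc n) summand                                      ≡⟨ sumTo-suc n summand ⟩
  summand 0 + sumTo n (summand ∘ suc)                        ≡⟨ cong₂ _+_ summand₀≡0 (sumTo-cong n (λ j _ → absorb j)) ⟩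
  0ℚ + sumTo n (λ j → - fromℕ (suc n) * term j)              ≡⟨ +-identityˡ _ ⟩
  sumTo n (λ j → - fromℕ (suc n) * term j)                   ≡⟨ sumTo-*ˡ n (- fromℕ (suc n)) term ⟩
  - fromℕ (suc n) * binomialHarmonic n                       ≡⟨ cong (- fromℕ (suc n) *_) (binomialHarmonic-suc m) ⟩
  - fromℕ (suc n) * (1/[1+ m ] * sign m)                     ≡⟨ reorder (fromℕ (suc n)) 1/[1+ m ] (sign m) ⟩
  - sign m * (fromℕ (suc n) * 1/[1+ m ])                     ≡⟨ cong (- sign m *_) (+/suc≡fromℕ*1/[1+] (suc n) m) ⟨
  sign (suc n ∸ 1) * (+ suc n / suc m)                       ∎
  where
  open ≡-Reasoning
  n = suc m
  summand : ℕ → ℚ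
  summand k = fromℕ (k ℕ.* (suc n C k)) * sign k * H (suc n ∸ k)
  term : ℕ → ℚ
  term j = n Cℚ j * (sign j * H (n ∸ j))
  summand₀≡0 : summand 0 ≡ 0ℚ
  summand₀≡0 = trans (cong (_* H (suc n)) (*-zeroˡ (sign 0))) (*-zeroˡ (H (suc n)))
  regroup : ∀ a c s h → a * c * - s * h ≡ - a * (c * (s * h))
  regroup = solve 4 (λ a c s h → a :* c :* (:- s) :* h := (:- a) :* (c :* (s :* h))) refl
  reorder : ∀ a r s → - a * (r * s) ≡ - s * (a * r)
  reorder = solve 3 (λ a r s → (:- a) :* (r :* s) := (:- s) :* (a :* r)) refl
  absorb : ∀ j → summand (suc j) ≡ - fromℕ (suc n) * term j
  absorb j = begin
    fromℕ (suc j ℕ.* (suc n C suc j)) * - sign j * H (n ∸ j)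
      ≡⟨ cong (λ x → x * - sign j * H (n ∸ j)) ([k+1]*[n+1]Cℚ[k+1]≡[n+1]*nCℚk n j) ⟩
    fromℕ (suc n) * n Cℚ j * - sign j * H (n ∸ j)
      ≡⟨ regroup (fromℕ (suc n)) (n Cℚ j) (sign j) (H (n ∸ j)) ⟩
    - fromℕ (suc n) * term j ∎
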